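{- For any positions $i$ of $S$ and $j$ of $S'$, the match graph induced by the single anchor $A(i,j)$, i.e. by the set of match variables $\{M(i+t,j+t):0\le t\le k-1\}$, has no cycles.
   Context: Let $\Sigma$ be an alphabet. Let $S$ be a length-$n$ string; fix $p\ge0$, $m'$ with $p+m'\le n$; $S'$ is obtained from $S[p+1:p+m']$ by a channel that at each position $p+j$ may substitute the letter, delete it, and/or insert a string immediately to its left. $k$ is the seed length. Homologous path $P_H$: list starting at $(p,0)$; while last element $(i,j)$ has $i+1\le p+m'$, append according to mutations at position $i+1$: no indel: $(i+1,j+1)$; insertion of $I$ letters, no deletion: $(i,j+1),\dots,(i,j+I),(i+1,j+I+1)$; deletion only: $(i+1,j)$; both: $(i,j+1),\dots,(i,j+I),(i+1,j+I)$. Define $f(x)=\max\{y:(x,y)\in P_H\}$ if $x\in[p+1,p+m']$ and $x$ is not deleted, and $f(x)=\emptyset$ otherwise. $M(i,j)=\mathbf 1\{S[i]=S'[j]\}$, $A(i,j)=\prod_{t=0}^{k-1}M(i+t,j+t)$. The match graph induced by a set $\mathcal{M}$ of match variables is the bipartite simple graph on the positions of $S$ and of $S'$ with edges $\{(x,f(x)):x\in[p+1,p+m'],f(x)\neq\emptyset\}\cup\{(a,b):M(a,b)\in\mathcal{M}\}$. -}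

module Defs where

open import Data.Nat using (ℕ; zero; suc; _+_; _≤_; _<_)
open import Data.Bool using (Bool; true; false; if_then_else_)
open import Data.Maybe using (Maybe; just; nothing; fromMaybe)
open import Data.List using (List; []; _∷_; _++_; length; take; drop; concat; zipWith)
open import Data.List.Membership.Propositional using (_∈_)
open import Data.List.Relation.Unary.Unique.Propositional using (Unique)
open import Data.List.Relation.Unary.Linked using (Linked)
open import Data.Product using (_×_; _,_; ∃; ∃-syntax)
open import Data.Sum using (_⊎_; inj₁; inj₂)
open import Data.Empty using (⊥)
open import Relation.Nullary using (¬_)
open import Relation.Binary.PropositionalEquality using (_≡_)

-- Strings are lists over an alphabet; positions are 1-based.

nth : {A : Set} → List A → ℕ → Maybe A
nth []       _       = nothing
nth (a ∷ as) zero    = just a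
nth (a ∷ as) (suc t) = nth as t

-- The channel: for each position p+j (j = 1..m') of S we record
--   sub : the substituted letter (nothing = letter kept)
--   del : whether the letter is deleted
--   ins : the string inserted immediately to its left

record Mut (Σ : Set) : Set where
  constructor mut
  field
    sub : Maybe Σ
    del : Bool
    ins : List Σ
open Mut public

emit : {Σ : Set} → Σ → Mut Σ → List Σ
emit c μ = ins μ ++ (if del μ then [] else (fromMaybe c (sub μ) ∷ []))

-- S' obtained from S[p+1 : p+m'] by the channel (muts lists the mutations
-- at positions p+1, ..., p+m' in order)
mutated : {Σ : Set} → List Σ → ℕ → ℕ → List (Mut Σ) → List Σ
mutated S p m' muts = concat (zipWith emit (take m' (drop p S)) muts)

insPts : ℕ → ℕ → ℕ → List (ℕ × ℕ)
insPts i j zero    = []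
insPts i j (suc I) = (i , suc j) ∷ insPts i (suc j) I

-- continue the path from its current last element (i , j),
-- processing the mutations at positions i+1, i+2, ...
pathFrom : {Σ : Set} → ℕ → ℕ → List (Mut Σ) → List (ℕ × ℕ)
pathFrom i j []         = []
pathFrom i j (μ ∷ muts) =
  let I  = length (ins μ)
      j' = if del μ then j + I else suc (j + I)
  in insPts i j I ++ ((suc i , j') ∷ pathFrom (suc i) j' muts)

homPath : {Σ : Set} → ℕ → List (Mut Σ) → List (ℕ × ℕ)
homPath p muts = (p , 0) ∷ pathFrom p 0 muts

Deleted : {Σ : Set} → ℕ → List (Mut Σ) → ℕ → Set
Deleted p muts x = ∃[ t ] ∃[ μ ] (x ≡ p + suc t × nth muts t ≡ just μ × del μ ≡ true)

FEdge : {Σ : Set} → ℕ → ℕ → List (Mut Σ) → ℕ → ℕ → Set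
FEdge p m' muts x y =
  suc p ≤ x × x ≤ p + m' × ¬ Deleted p muts x ×
  (x , y) ∈ homPath p muts ×
  (∀ y' → (x , y') ∈ homPath p muts → y' ≤ y)

AnchorVar : ℕ → ℕ → ℕ → ℕ → ℕ → ℕ → ℕ → Set
AnchorVar n n' k i j a b =
  ∃[ t ] (t < k × a ≡ i + t × b ≡ j + t) ×
  1 ≤ a × a ≤ n × 1 ≤ b × b ≤ n'

MatchEdge : {Σ : Set} → (S : List Σ) → (p m' : ℕ) → List (Mut Σ) →
            (k i j : ℕ) → ℕ → ℕ → Set
MatchEdge S p m' muts k i j a b =
  FEdge p m' muts a b ⊎
  AnchorVar (length S) (length (mutated S p m' muts)) k i j a b

-- Simple bipartite graphs and cycles.
-- Vertices: inj₁ a = position a of S, inj₂ b = position b of S'.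

Vertex : Set
Vertex = ℕ ⊎ ℕ

Adj : (ℕ → ℕ → Set) → Vertex → Vertex → Set
Adj E (inj₁ a) (inj₂ b) = E a b
Adj E (inj₂ b) (inj₁ a) = E a b
Adj E (inj₁ _) (inj₁ _) = ⊥
Adj E (inj₂ _) (inj₂ _) = ⊥

IsCycle : (ℕ → ℕ → Set) → List Vertex → Set
IsCycle E c = 3 ≤ length c × Unique c × Linked (Adj E) (c ++ take 1 c)

HasCycle : (ℕ → ℕ → Set) → Set
HasCycle E = ∃[ c ] IsCycle E c

-- Both kinds of edges of the match graph form strictly order-preserving
-- partial matchings: the homologous edges x ↦ f(x), because the homologous
-- path is monotone and strictly climbs whenever it enters an undeleted
-- position, and the anchor edges (i + t, j + t), which lie on a diagonal.
-- In the union of two such matchings consecutive edges of a non-backtracking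
-- walk alternate between the matchings, so the two outer edges of any
-- three-edge stretch lie in one matching and are ordered alike.  Hence the
-- sum of the endpoints of the edges is strictly monotone along the walk,
-- and a cycle, which returns to its first edge, cannot exist.
module Submission where

open import Defs
open import Data.Nat using (ℕ; zero; suc; _+_; _≤_; _<_; z≤n; s≤s)
open import Data.Nat.Properties
open import Data.Bool using (true; false; if_then_else_)
open import Data.Bool.Properties using (¬-not)
open import Data.List using (List; []; _∷_; _++_; length)
open import Data.List.Membership.Propositional using (_∈_)
open import Data.List.Membership.Propositional.Properties using (∈-++⁻; ∈-++⁺ʳ)
open import Data.List.Relation.Unary.All as All using (All; _∷_)
open import Data.List.Relation.Unary.AllPairs using (_∷_)
open import Data.List.Relation.Unary.Any using (here; there)
open import Data.List.Relation.Unary.Linked using (Linked; [-]; _∷_)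
open import Data.List.Relation.Unary.Unique.Propositional using (Unique)
open import Data.Maybe using (just)
open import Data.Product using (_×_; _,_; proj₁; proj₂; map₂; ∃-syntax)
open import Data.Sum using (_⊎_; inj₁; inj₂; [_,_])
open import Data.Empty using (⊥-elim)
open import Function using (_∘_; flip)
open import Relation.Nullary using (¬_)
open import Relation.Binary.Definitions using (tri<; tri≈; tri>)
open import Relation.Binary.PropositionalEquality
  using (_≡_; _≢_; refl; sym; cong; subst; ≢-sym)

record OrderPreserving (R : ℕ → ℕ → Set) : Set where
  field
    functional : ∀ {a b b′} → R a b → R a b′ → b ≡ b′
    monotone   : ∀ {a b a′ b′} → R a b → R a′ b′ → a < a′ → b < b′

module _ {R : ℕ → ℕ → Set} (op : OrderPreserving R) where
  open OrderPreserving op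

  injective : ∀ {a a′ b} → R a b → R a′ b → a ≡ a′
  injective {a} {a′} r r′ with <-cmp a a′
  ... | tri< a<a′ _ _ = ⊥-elim (<-irrefl refl (monotone r r′ a<a′))
  ... | tri≈ _ a≡a′ _ = a≡a′
  ... | tri> _ _ a′<a = ⊥-elim (<-irrefl refl (monotone r′ r a′<a))

  reflects : ∀ {a b a′ b′} → R a b → R a′ b′ → b < b′ → a < a′
  reflects {a} {_} {a′} r r′ b<b′ with <-cmp a a′
  ... | tri< a<a′ _ _ = a<a′
  ... | tri≈ _ refl _ = ⊥-elim (<-irrefl (functional r r′) b<b′)
  ... | tri> _ _ a′<a = ⊥-elim (<-asym b<b′ (monotone r′ r a′<a))

transpose : ∀ {R} → OrderPreserving R → OrderPreserving (flip R)
transpose op = record { functional = injective op ; monotone = reflects op }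

module _ {F G : ℕ → ℕ → Set} (opF : OrderPreserving F) (opG : OrderPreserving G) where
  open OrderPreserving

  outer-edges-agree : ∀ {a b₀ b₂ a₃} →
    F a b₀ ⊎ G a b₀ → F a b₂ ⊎ G a b₂ → F a₃ b₂ ⊎ G a₃ b₂ → b₀ ≢ b₂ → a ≢ a₃ →
    (F a b₀ × F a₃ b₂) ⊎ (G a b₀ × G a₃ b₂)
  outer-edges-agree (inj₁ f₁) (inj₁ f₂) _         b₀≢b₂ _ = ⊥-elim (b₀≢b₂ (functional opF f₁ f₂))
  outer-edges-agree (inj₂ g₁) (inj₂ g₂) _         b₀≢b₂ _ = ⊥-elim (b₀≢b₂ (functional opG g₁ g₂))
  outer-edges-agree (inj₁ f₁) (inj₂ _)  (inj₁ f₃) _     _ = inj₁ (f₁ , f₃)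
  outer-edges-agree (inj₁ _)  (inj₂ g₂) (inj₂ g₃) _ a≢a₃ = ⊥-elim (a≢a₃ (injective opG g₂ g₃))
  outer-edges-agree (inj₂ _)  (inj₁ f₂) (inj₁ f₃) _ a≢a₃ = ⊥-elim (a≢a₃ (injective opF f₂ f₃))
  outer-edges-agree (inj₂ g₁) (inj₁ _)  (inj₂ g₃) _     _ = inj₂ (g₁ , g₃)

  turn : ∀ {a b₀ b₂ a₃} →
    F a b₀ ⊎ G a b₀ → F a b₂ ⊎ G a b₂ → F a₃ b₂ ⊎ G a₃ b₂ → b₀ ≢ b₂ → a ≢ a₃ →
    (b₀ < b₂ → a < a₃) × (b₂ < b₀ → a₃ < a)
  turn e₁ e₂ e₃ b₀≢b₂ a≢a₃ =
    [ (λ (f₁ , f₃) → reflects opF f₁ f₃ , reflects opF f₃ f₁)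
    , (λ (g₁ , g₃) → reflects opG g₁ g₃ , reflects opG g₃ g₁)
    ] (outer-edges-agree e₁ e₂ e₃ b₀≢b₂ a≢a₃)

∣_∣ : Vertex → ℕ
∣ inj₁ a ∣ = a
∣ inj₂ b ∣ = b

key : Vertex → Vertex → ℕ
key u v = ∣ u ∣ + ∣ v ∣

key-< : ∀ u v w → ∣ u ∣ < ∣ w ∣ → key u v < key v w
key-< u v w u<w = subst (key u v <_) (+-comm ∣ w ∣ ∣ v ∣) (+-monoˡ-< ∣ v ∣ u<w)

key-> : ∀ u v w → ∣ w ∣ < ∣ u ∣ → key v w < key u v
key-> u v w w<u = subst (_< key u v) (+-comm ∣ w ∣ ∣ v ∣) (+-monoˡ-< ∣ v ∣ w<u)

-- Walk R u v y z : a non-backtracking R-walk with first edge u v and last edge y z.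
data Walk (R : Vertex → Vertex → Set) : Vertex → Vertex → Vertex → Vertex → Set where
  edge : ∀ {u v} → R u v → Walk R u v u v
  step : ∀ {u v w y z} → u ≢ w → R u v → Walk R v w y z → Walk R u v y z

first-edge : ∀ {R u v y z} → Walk R u v y z → R u v
first-edge (edge e)     = e
first-edge (step _ e _) = e

module _ {F G : ℕ → ℕ → Set} (opF : OrderPreserving F) (opG : OrderPreserving G) where
  private
    E : ℕ → ℕ → Set
    E a b = F a b ⊎ G a b

  ∣∣-injective-two-apart : ∀ {u v w} → Adj E u v → Adj E v w → u ≢ w → ∣ u ∣ ≢ ∣ w ∣
  ∣∣-injective-two-apart {inj₂ _} {inj₁ _} {inj₂ _} _ _ u≢w = u≢w ∘ cong inj₂
  ∣∣-injective-two-apart {inj₁ _} {inj₂ _} {inj₁ _} _ _ u≢w = u≢w ∘ cong inj₁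
  ∣∣-injective-two-apart {inj₁ _} {inj₁ _} () _ _
  ∣∣-injective-two-apart {inj₂ _} {inj₂ _} () _ _
  ∣∣-injective-two-apart {inj₁ _} {inj₂ _} {inj₂ _} _ () _
  ∣∣-injective-two-apart {inj₂ _} {inj₁ _} {inj₁ _} _ () _

  Adj-turn : ∀ {u v w x} → Adj E u v → Adj E v w → Adj E w x → u ≢ w → v ≢ x →
              (∣ u ∣ < ∣ w ∣ → ∣ v ∣ < ∣ x ∣) × (∣ w ∣ < ∣ u ∣ → ∣ x ∣ < ∣ v ∣)
  Adj-turn {inj₂ _} {inj₁ _} {inj₂ _} {inj₁ _} e₁ e₂ e₃ u≢w v≢x =
    turn opF opG e₁ e₂ e₃ (u≢w ∘ cong inj₂) (v≢x ∘ cong inj₁)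
  Adj-turn {inj₁ _} {inj₂ _} {inj₁ _} {inj₂ _} e₁ e₂ e₃ u≢w v≢x =
    turn (transpose opF) (transpose opG) e₁ e₂ e₃ (u≢w ∘ cong inj₁) (v≢x ∘ cong inj₂)
  Adj-turn {inj₁ _} {inj₁ _} () _ _ _ _
  Adj-turn {inj₂ _} {inj₂ _} () _ _ _ _
  Adj-turn {inj₁ _} {inj₂ _} {inj₂ _} _ () _ _ _
  Adj-turn {inj₂ _} {inj₁ _} {inj₁ _} _ () _ _ _
  Adj-turn {inj₁ _} {inj₂ _} {inj₁ _} {inj₁ _} _ _ () _ _
  Adj-turn {inj₂ _} {inj₁ _} {inj₂ _} {inj₂ _} _ _ () _ _

  walk-key-ascending : ∀ {u v w y z} → Walk (Adj E) v w y z → u ≢ w → Adj E u v →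
                       ∣ u ∣ < ∣ w ∣ → key u v < key y z
  walk-key-ascending {u} {v} {w} (edge _) _ _ u<w = key-< u v w u<w
  walk-key-ascending {u} {v} {w} (step v≢x e₂ walk) u≢w e₁ u<w =
    <-trans (key-< u v w u<w)
            (walk-key-ascending walk v≢x e₂ (proj₁ (Adj-turn e₁ e₂ (first-edge walk) u≢w v≢x) u<w))

  walk-key-descending : ∀ {u v w y z} → Walk (Adj E) v w y z → u ≢ w → Adj E u v →
                        ∣ w ∣ < ∣ u ∣ → key y z < key u v
  walk-key-descending {u} {v} {w} (edge _) _ _ w<u = key-> u v w w<u
  walk-key-descending {u} {v} {w} (step v≢x e₂ walk) u≢w e₁ w<u =
    <-trans (walk-key-descending walk v≢x e₂ (proj₂ (Adj-turn e₁ e₂ (first-edge walk) u≢w v≢x) w<u))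
            (key-> u v w w<u)

  closed-walk : ∀ {x y z z′} xs → Linked (Adj E) (x ∷ y ∷ xs ++ z ∷ []) → Adj E z z′ →
                Unique (x ∷ y ∷ xs) → All (_≢ z) (x ∷ y ∷ xs) → All (_≢ z′) (y ∷ xs) →
                Walk (Adj E) x y z z′
  closed-walk [] (e₁ ∷ e₂ ∷ [-]) e₃ _ (x≢z ∷ _) (y≢z′ ∷ _) = step x≢z e₁ (step y≢z′ e₂ (edge e₃))
  closed-walk (w ∷ xs) (e₁ ∷ es) e₃ ((_ ∷ x≢w ∷ _) ∷ unique) (_ ∷ ≢z) (_ ∷ ≢z′) =
    step x≢w e₁ (closed-walk xs es e₃ unique ≢z ≢z′)

  no-closed-walk : ∀ {u v w} → u ≢ w → Adj E u v → ¬ Walk (Adj E) v w u v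
  no-closed-walk {u} {v} {w} u≢w e walk with <-cmp ∣ u ∣ ∣ w ∣
  ... | tri< u<w _ _ = <-irrefl refl (walk-key-ascending walk u≢w e u<w)
  ... | tri≈ _ u≡w _ = ∣∣-injective-two-apart e (first-edge walk) u≢w u≡w
  ... | tri> _ _ w<u = <-irrefl refl (walk-key-descending walk u≢w e w<u)

  union-acyclic : ¬ HasCycle E
  union-acyclic ((v₀ ∷ v₁ ∷ v₂ ∷ vs) , _ , (v₀≢@(_ ∷ v₀≢v₂ ∷ _) ∷ unique@(v₁≢ ∷ _)) , e₀₁ ∷ es) =
    no-closed-walk v₀≢v₂ e₀₁
      (closed-walk vs es e₀₁ unique (All.map ≢-sym v₀≢) (All.map ≢-sym v₁≢))
  union-acyclic ((_ ∷ []) , s≤s () , _)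
  union-acyclic ((_ ∷ _ ∷ []) , s≤s (s≤s ()) , _)

anchor-orderPreserving : ∀ n n′ k i j → OrderPreserving (AnchorVar n n′ k i j)
anchor-orderPreserving n n′ k i j = record { functional = functional ; monotone = monotone }
  where
    functional : ∀ {a b b′} → AnchorVar n n′ k i j a b → AnchorVar n n′ k i j a b′ → b ≡ b′
    functional (t , (_ , refl , refl) , _) (t′ , (_ , i+t≡i+t′ , refl) , _) =
      cong (j +_) (+-cancelˡ-≡ i t t′ i+t≡i+t′)
    monotone : ∀ {a b a′ b′} → AnchorVar n n′ k i j a b → AnchorVar n n′ k i j a′ b′ → a < a′ → b < b′
    monotone (t , (_ , refl , refl) , _) (t′ , (_ , refl , refl) , _) i+t<i+t′ =
      +-monoʳ-< j (+-cancelˡ-< i t t′ i+t<i+t′)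

nth-just : ∀ {A : Set} (xs : List A) t → t < length xs → ∃[ a ] (nth xs t ≡ just a)
nth-just (a ∷ xs) zero    _         = a , refl
nth-just (a ∷ xs) (suc t) (s≤s t<n) = nth-just xs t t<n

module _ {Σ : Set} where

  next : ℕ → Mut Σ → ℕ
  next j μ = if del μ then j + length (ins μ) else suc (j + length (ins μ))

  next-≥ : ∀ j μ → j + length (ins μ) ≤ next j μ
  next-≥ j (mut _ true  _) = ≤-refl
  next-≥ j (mut _ false _) = n≤1+n _

  next->-undeleted : ∀ j μ → del μ ≡ false → j + length (ins μ) < next j μ
  next->-undeleted j (mut _ false _) refl = ≤-refl

  insPts-∈ : ∀ {x y} i j I → (x , y) ∈ insPts i j I → x ≡ i × y ≤ j + I
  insPts-∈ i j (suc I) (here refl) = refl , subst (suc j ≤_) (sym (+-suc j I)) (s≤s (m≤m+n j I))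
  insPts-∈ {y = y} i j (suc I) (there p) with insPts-∈ i (suc j) I p
  ... | x≡i , y≤ = x≡i , subst (y ≤_) (sym (+-suc j I)) y≤

  ∈-pathFrom-∷ : ∀ {x y} i j μ (ms : List (Mut Σ)) → (x , y) ∈ (i , j) ∷ pathFrom i j (μ ∷ ms) →
                 (x ≡ i × y ≤ j + length (ins μ)) ⊎
                 (x , y) ∈ (suc i , next j μ) ∷ pathFrom (suc i) (next j μ) ms
  ∈-pathFrom-∷ i j μ ms (here refl) = inj₁ (refl , m≤m+n j _)
  ∈-pathFrom-∷ i j μ ms (there p) with ∈-++⁻ (insPts i j (length (ins μ))) p
  ... | inj₁ p₁ = inj₁ (insPts-∈ i j _ p₁)
  ... | inj₂ p₂ = inj₂ p₂

  pathFrom-fst-≥ : ∀ {x y} i j (ms : List (Mut Σ)) → (x , y) ∈ (i , j) ∷ pathFrom i j ms → i ≤ x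
  pathFrom-fst-≥ i j []       (here refl) = ≤-refl
  pathFrom-fst-≥ i j (μ ∷ ms) p with ∈-pathFrom-∷ i j μ ms p
  ... | inj₁ (refl , _) = ≤-refl
  ... | inj₂ p′         = <⇒≤ (pathFrom-fst-≥ (suc i) (next j μ) ms p′)

  pathFrom-enters : ∀ {x y μ} i j (ms : List (Mut Σ)) t → nth ms t ≡ just μ → del μ ≡ false →
                    (x , y) ∈ (i , j) ∷ pathFrom i j ms → x < i + suc t →
                    ∃[ e ] ((i + suc t , e) ∈ pathFrom i j ms × y < e)
  pathFrom-enters {x} i j (ν ∷ ms) zero refl undel p x<i+1 with ∈-pathFrom-∷ i j ν ms p
  ... | inj₁ (_ , y≤) =
    next j ν , subst (λ x′ → (x′ , next j ν) ∈ pathFrom i j (ν ∷ ms)) (+-comm 1 i)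
                     (∈-++⁺ʳ (insPts i j (length (ins ν))) (here refl)) ,
    ≤-<-trans y≤ (next->-undeleted j ν undel)
  ... | inj₂ p′ =
    ⊥-elim (<-irrefl refl (<-≤-trans (subst (x <_) (+-comm i 1) x<i+1)
                                      (pathFrom-fst-≥ (suc i) (next j ν) ms p′)))
  pathFrom-enters {x} i j (ν ∷ ms) (suc t) nth≡ undel p x<i+t+2 =
    [ (λ (_ , y≤) → map₂ (map₂ (≤-<-trans (≤-trans y≤ (next-≥ j ν))))
                         (later (here refl) (m<m+n (suc i) (s≤s z≤n))))
    , (λ p′ → later p′ (subst (x <_) (+-suc i (suc t)) x<i+t+2))
    ] (∈-pathFrom-∷ i j ν ms p)
    where
      later : ∀ {x′ y′} → (x′ , y′) ∈ (suc i , next j ν) ∷ pathFrom (suc i) (next j ν) ms →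
              x′ < suc i + suc t → ∃[ e ] ((i + suc (suc t) , e) ∈ pathFrom i j (ν ∷ ms) × y′ < e)
      later p′ x′< with pathFrom-enters (suc i) (next j ν) ms t nth≡ undel p′ x′<
      ... | e , e∈ , y′<e =
        e , subst (λ x″ → (x″ , e) ∈ pathFrom i j (ν ∷ ms)) (sym (+-suc i (suc t)))
                  (∈-++⁺ʳ (insPts i j (length (ins ν))) (there e∈)) , y′<e

  undeleted-mutation : ∀ p (muts : List (Mut Σ)) {x} → suc p ≤ x → x ≤ p + length muts → ¬ Deleted p muts x →
              ∃[ t ] ∃[ μ ] (x ≡ p + suc t × nth muts t ≡ just μ × del μ ≡ false)
  undeleted-mutation p muts p<x x≤ notDeleted with m≤n⇒∃[o]m+o≡n p<x
  ... | t , refl = t , μ , x≡ , nth≡ , ¬-not (λ deleted → notDeleted (t , μ , x≡ , nth≡ , deleted))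
    where
      x≡ : suc (p + t) ≡ p + suc t
      x≡ = sym (+-suc p t)
      mutation : ∃[ μ ] (nth muts t ≡ just μ)
      mutation = nth-just muts t (+-cancelˡ-≤ p (suc t) _ (subst (_≤ p + length muts) x≡ x≤))
      μ : Mut Σ
      μ = proj₁ mutation
      nth≡ : nth muts t ≡ just μ
      nth≡ = proj₂ mutation

  homologous-orderPreserving : ∀ p m′ (muts : List (Mut Σ)) → length muts ≡ m′ →
                               OrderPreserving (FEdge p m′ muts)
  homologous-orderPreserving p _ muts refl = record { functional = functional ; monotone = monotone }
    where
      functional : ∀ {a b b′} → FEdge p _ muts a b → FEdge p _ muts a b′ → b ≡ b′
      functional (_ , _ , _ , ab∈ , ≤b) (_ , _ , _ , ab′∈ , ≤b′) = ≤-antisym (≤b′ _ ab∈) (≤b _ ab′∈)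
      monotone : ∀ {a b a′ b′} → FEdge p _ muts a b → FEdge p _ muts a′ b′ → a < a′ → b < b′
      monotone (_ , _ , _ , ab∈ , _) (p<a′ , a′≤ , notDeleted , _ , ≤b′) a<a′
        with undeleted-mutation p muts p<a′ a′≤ notDeleted
      ... | t , μ , refl , nth≡ , undel with pathFrom-enters p 0 muts t nth≡ undel ab∈ a<a′
      ...   | e , a′e∈ , b<e = <-≤-trans b<e (≤b′ e (there a′e∈))

lemma16 : {Σ : Set} (S : List Σ) (p m' : ℕ) (muts : List (Mut Σ)) (k : ℕ) →
          p + m' ≤ length S → length muts ≡ m' →
          (i j : ℕ) → 1 ≤ i → i ≤ length S →
          1 ≤ j → j ≤ length (mutated S p m' muts) →
          ¬ HasCycle (MatchEdge S p m' muts k i j)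
lemma16 S p m' muts k _ m'≡ i j _ _ _ _ =
  union-acyclic (homologous-orderPreserving p m' muts m'≡)
                (anchor-orderPreserving (length S) (length (mutated S p m' muts)) k i j)
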